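{- Let $n\ge 1$ and let $f : \{0,1\}^n \to \{0,1\}$ be a symmetric Boolean function. Let $0 \leq \ell_0(f) \leq \ell_1(f) \leq n$ be the end points of a largest interval of Hamming weights on which $f$ is constant, i.e. integers such that $f$ takes the same value on all inputs of Hamming weight in $\{\ell_0(f), \dots, \ell_1(f)\}$ and $\ell_1(f) - \ell_0(f)$ is maximal among all such intervals. Then $\mathsf{C}_{\mathsf{min}}(f) = \ell_0(f) + n - \ell_1(f)$.
   Context: A function $f:\{0,1\}^n\to\{0,1\}$ is symmetric if $f(x)$ depends only on the Hamming weight $|x|$ (number of 1s in $x$). For $x\in\{0,1\}^n$ and $S\subseteq[n]$, $x_S$ is the restriction of $x$ to coordinates in $S$. A certificate for $x$ w.r.t. $f$ is a set $S\subseteq[n]$ such that $f(y)=f(x)$ for all $y$ with $y_S=x_S$; $\mathsf{C}(f,x)$ is the minimum size of such a set, and $\mathsf{C}_{\mathsf{min}}(f)=\min_{x\in\{0,1\}^n} \mathsf{C}(f,x)$. -}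

module Defs where

open import Data.Nat using (ℕ; zero; suc; _≤_; _∸_)
open import Data.Bool using (Bool; true; false)
open import Data.Fin using (Fin)
open import Data.Vec using (Vec; []; _∷_; lookup)
open import Data.Product using (Σ; _×_; ∃)
open import Relation.Binary.PropositionalEquality using (_≡_)

weight : ∀ {n} → Vec Bool n → ℕ
weight [] = 0
weight (true ∷ xs) = suc (weight xs)
weight (false ∷ xs) = weight xs

Symmetric : ∀ {n} → (Vec Bool n → Bool) → Set
Symmetric {n} f = ∀ (x y : Vec Bool n) → weight x ≡ weight y → f x ≡ f y

-- A subset S ⊆ [n] is a characteristic vector; its size is its weight.
-- y agrees with x on S (y_S = x_S).
AgreeOn : ∀ {n} → Vec Bool n → Vec Bool n → Vec Bool n → Set
AgreeOn {n} S x y = ∀ (i : Fin n) → lookup S i ≡ true → lookup y i ≡ lookup x i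

Certificate : ∀ {n} → (Vec Bool n → Bool) → Vec Bool n → Vec Bool n → Set
Certificate {n} f x S = ∀ (y : Vec Bool n) → AgreeOn S x y → f y ≡ f x

IsCmin : ∀ {n} → (Vec Bool n → Bool) → ℕ → Set
IsCmin {n} f k =
  (Σ (Vec Bool n) λ x → Σ (Vec Bool n) λ S → Certificate f x S × weight S ≡ k)
  × (∀ (x S : Vec Bool n) → Certificate f x S → k ≤ weight S)

ConstOnWeights : ∀ {n} → (Vec Bool n → Bool) → ℕ → ℕ → Set
ConstOnWeights {n} f a b = ∀ (x y : Vec Bool n) →
  a ≤ weight x → weight x ≤ b → a ≤ weight y → weight y ≤ b → f x ≡ f y

LargestConstInterval : ∀ {n} → (Vec Bool n → Bool) → ℕ → ℕ → Set
LargestConstInterval {n} f l0 l1 =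
  l0 ≤ l1 × l1 ≤ n × ConstOnWeights f l0 l1
  × (∀ (a b : ℕ) → a ≤ b → b ≤ n → ConstOnWeights f a b → b ∸ a ≤ l1 ∸ l0)

-- Fixing the coordinates in S to the values of x leaves exactly the weights from
-- (number of ones of x inside S) to that plus n − |S| reachable, and a symmetric f
-- must be constant on that whole interval; so n − |S| ≤ ℓ₁ − ℓ₀ for every certificate.
-- Conversely, fixing ℓ₀ ones and n − ℓ₁ zeros pins the weight into [ℓ₀, ℓ₁].
module Submission where

open import Defs
open import Data.Nat using (ℕ; _≤_; _+_; _∸_; zero; suc; z≤n; s≤s)
open import Data.Nat.Properties
open import Data.Bool using (Bool; true; false; not; _∧_)
open import Data.Vec using (Vec; []; _∷_; map; zipWith)
open import Data.Fin using () renaming (zero to fzero; suc to fsuc)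
open import Data.Product using (Σ; _×_; _,_; proj₁; proj₂)
open import Relation.Binary.PropositionalEquality

∷-agree : ∀ {n} {s c d : Bool} {S x y : Vec Bool n} →
  (s ≡ true → d ≡ c) → AgreeOn S x y → AgreeOn (s ∷ S) (c ∷ x) (d ∷ y)
∷-agree head-agrees tail-agrees fzero     = head-agrees
∷-agree head-agrees tail-agrees (fsuc i) = tail-agrees i

agree-tail : ∀ {n} {s c d : Bool} {S x y : Vec Bool n} →
  AgreeOn (s ∷ S) (c ∷ x) (d ∷ y) → AgreeOn S x y
agree-tail agrees i = agrees (fsuc i)

agree-head : ∀ {n} {c d : Bool} {S x y : Vec Bool n} →
  AgreeOn (true ∷ S) (c ∷ x) (d ∷ y) → d ≡ c
agree-head agrees = agrees fzero refl

agree-refl : ∀ {n} (S x : Vec Bool n) → AgreeOn S x x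
agree-refl S x i _ = refl

weight+weight-not≡length : ∀ {n} (S : Vec Bool n) → weight S + weight (map not S) ≡ n
weight+weight-not≡length []          = refl
weight+weight-not≡length (true ∷ S)  = cong suc (weight+weight-not≡length S)
weight+weight-not≡length (false ∷ S) =
  trans (+-suc (weight S) _) (cong suc (weight+weight-not≡length S))

pinnedOnes : ∀ {n} → Vec Bool n → Vec Bool n → ℕ
pinnedOnes S x = weight (zipWith _∧_ S x)

pinnedOnes≤weight : ∀ {n} (S x : Vec Bool n) → pinnedOnes S x ≤ weight S
pinnedOnes≤weight []          []          = z≤n
pinnedOnes≤weight (true ∷ S)  (true ∷ x)  = s≤s (pinnedOnes≤weight S x)
pinnedOnes≤weight (true ∷ S)  (false ∷ x) = m≤n⇒m≤1+n (pinnedOnes≤weight S x)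
pinnedOnes≤weight (false ∷ S) (_ ∷ x)     = pinnedOnes≤weight S x

agreeing-weight : ∀ {n} (S x : Vec Bool n) k → k ≤ weight (map not S) →
  Σ (Vec Bool n) λ y → AgreeOn S x y × weight y ≡ pinnedOnes S x + k
agreeing-weight [] [] zero _ = [] , (λ ()) , refl
agreeing-weight (true ∷ S) (true ∷ x) k k≤free with agreeing-weight S x k k≤free
... | y , agrees , wy = true ∷ y , ∷-agree (λ _ → refl) agrees , cong suc wy
agreeing-weight (true ∷ S) (false ∷ x) k k≤free with agreeing-weight S x k k≤free
... | y , agrees , wy = false ∷ y , ∷-agree (λ _ → refl) agrees , wy
agreeing-weight (false ∷ S) (_ ∷ x) zero _ with agreeing-weight S x zero z≤n
... | y , agrees , wy = false ∷ y , ∷-agree (λ ()) agrees , wy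
agreeing-weight (false ∷ S) (_ ∷ x) (suc k) (s≤s k≤free) with agreeing-weight S x k k≤free
... | y , agrees , wy =
  true ∷ y , ∷-agree (λ ()) agrees , trans (cong suc wy) (sym (+-suc _ k))

certificate⇒constOnWeights : ∀ {n} {f : Vec Bool n → Bool} {x S : Vec Bool n} →
  Symmetric f → Certificate f x S →
  ConstOnWeights f (pinnedOnes S x) (pinnedOnes S x + weight (map not S))
certificate⇒constOnWeights {f = f} {x} {S} symmetric certificate z z′ a≤z z≤b a≤z′ z′≤b =
  trans (≡f[x] z a≤z z≤b) (sym (≡f[x] z′ a≤z′ z′≤b))
  where
  a = pinnedOnes S x
  free = weight (map not S)
  ≡f[x] : ∀ z → a ≤ weight z → weight z ≤ a + free → f z ≡ f x
  ≡f[x] z a≤z z≤b with agreeing-weight S x (weight z ∸ a)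
                         (subst (weight z ∸ a ≤_) (m+n∸m≡n a free) (∸-monoˡ-≤ a z≤b))
  ... | y , agrees , wy =
    trans (symmetric z y (trans (sym (m+[n∸m]≡n a≤z)) (sym wy))) (certificate y agrees)

size-from-free : ∀ {s r l0 l1 n} → l0 ≤ l1 → l1 ≤ n → s + r ≡ n → r ≤ l1 ∸ l0 →
  l0 + (n ∸ l1) ≤ s
size-from-free {s} {r} {l0} {l1} {n} l0≤l1 l1≤n s+r≡n r≤gap =
  +-cancelʳ-≤ r (l0 + (n ∸ l1)) s (begin
    l0 + (n ∸ l1) + r          ≤⟨ +-monoʳ-≤ (l0 + (n ∸ l1)) r≤gap ⟩
    l0 + (n ∸ l1) + (l1 ∸ l0)  ≡⟨ +-assoc l0 (n ∸ l1) (l1 ∸ l0) ⟩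
    l0 + ((n ∸ l1) + (l1 ∸ l0)) ≡⟨ cong (l0 +_) (+-comm (n ∸ l1) (l1 ∸ l0)) ⟩
    l0 + ((l1 ∸ l0) + (n ∸ l1)) ≡⟨ sym (+-assoc l0 (l1 ∸ l0) (n ∸ l1)) ⟩
    l0 + (l1 ∸ l0) + (n ∸ l1)  ≡⟨ cong (_+ (n ∸ l1)) (m+[n∸m]≡n l0≤l1) ⟩
    l1 + (n ∸ l1)              ≡⟨ m+[n∸m]≡n l1≤n ⟩
    n                          ≡⟨ sym s+r≡n ⟩
    s + r                      ∎)
  where open ≤-Reasoning

certificate-size : ∀ {n} {f : Vec Bool n → Bool} {l0 l1 : ℕ} → Symmetric f →
  LargestConstInterval f l0 l1 → ∀ (x S : Vec Bool n) → Certificate f x S →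
  l0 + (n ∸ l1) ≤ weight S
certificate-size symmetric (l0≤l1 , l1≤n , _ , largest) x S certificate =
  size-from-free l0≤l1 l1≤n (weight+weight-not≡length S)
    (subst (_≤ _) (m+n∸m≡n a free) (largest a (a + free) (m≤m+n a free) a+free≤n
      (certificate⇒constOnWeights {S = S} symmetric certificate)))
  where
  a = pinnedOnes S x
  free = weight (map not S)
  a+free≤n : a + free ≤ _
  a+free≤n = subst (a + free ≤_) (weight+weight-not≡length S)
                   (+-monoˡ-≤ free (pinnedOnes≤weight S x))

PinsWeights : ∀ {n} → Vec Bool n → Vec Bool n → ℕ → ℕ → Set
PinsWeights S x i j = ∀ y → AgreeOn S x y → i ≤ weight y × weight y ≤ j

pinning : (n i j : ℕ) → i ≤ j → j ≤ n →
  Σ (Vec Bool n) λ x → Σ (Vec Bool n) λ S → PinsWeights S x i j × weight S ≡ i + (n ∸ j)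
pinning zero zero zero _ _ = [] , [] , (λ { [] _ → z≤n , z≤n }) , refl
pinning (suc n) (suc i) (suc j) (s≤s i≤j) (s≤s j≤n) with pinning n i j i≤j j≤n
... | x , S , pins , wS = true ∷ x , true ∷ S , pins′ , cong suc wS
  where
  pins′ : PinsWeights (true ∷ S) (true ∷ x) (suc i) (suc j)
  pins′ (d ∷ y) agrees with agree-head {S = S} {x = x} agrees
  ... | refl = let i≤y , y≤j = pins y (agree-tail agrees) in s≤s i≤y , s≤s y≤j
pinning (suc n) zero zero _ _ with pinning n zero zero z≤n z≤n
... | x , S , pins , wS = false ∷ x , true ∷ S , pins′ , cong suc wS
  where
  pins′ : PinsWeights (true ∷ S) (false ∷ x) zero zero
  pins′ (d ∷ y) agrees with agree-head {S = S} {x = x} agrees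
  ... | refl = pins y (agree-tail agrees)
pinning (suc n) zero (suc j) _ (s≤s j≤n) with pinning n zero j z≤n j≤n
... | x , S , pins , wS = false ∷ x , false ∷ S , pins′ , wS
  where
  pins′ : PinsWeights (false ∷ S) (false ∷ x) zero (suc j)
  pins′ (true ∷ y) agrees  = z≤n , s≤s (proj₂ (pins y (agree-tail agrees)))
  pins′ (false ∷ y) agrees = z≤n , m≤n⇒m≤1+n (proj₂ (pins y (agree-tail agrees)))

pinning⇒certificate : ∀ {n} {f : Vec Bool n → Bool} {x S : Vec Bool n} {i j : ℕ} →
  ConstOnWeights f i j → PinsWeights S x i j → Certificate f x S
pinning⇒certificate {x = x} {S} const pins y agrees =
  const y x i≤y y≤j i≤x x≤j
  where
  i≤y = proj₁ (pins y agrees)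
  y≤j = proj₂ (pins y agrees)
  i≤x = proj₁ (pins x (agree-refl S x))
  x≤j = proj₂ (pins x (agree-refl S x))

claim3p2 : (n : ℕ) → 1 ≤ n → (f : Vec Bool n → Bool) → Symmetric f →
    (l0 l1 : ℕ) → LargestConstInterval f l0 l1 → IsCmin f (l0 + (n ∸ l1))
claim3p2 n _ f symmetric l0 l1 largest@(l0≤l1 , l1≤n , const , _) =
  optimal , certificate-size symmetric largest
  where
  optimal : Σ (Vec Bool n) λ x → Σ (Vec Bool n) λ S →
    Certificate f x S × weight S ≡ l0 + (n ∸ l1)
  optimal with pinning n l0 l1 l0≤l1 l1≤n
  ... | x , S , pins , wS = x , S , pinning⇒certificate {S = S} const pins , wS
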